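{- Let $k$ be a natural number and $G$ a subcubic graph which is the union of a $\theta$-graph $\Theta=(P_1,P_2,P_3)$ and a matching $M$ such that every edge in $M$ has its endpoints on two different legs of $\Theta$. If $|M|\geq 3k^2$, then $G$ has a cycle $C$ such that $|E(C)\cap M|\geq k$.
   Context: All graphs are finite and simple; subcubic means maximum degree at most 3. A $\theta$-graph $\Theta=(P_1,P_2,P_3)$ consists of two vertices $u,v$ and three pairwise internally disjoint $u-v$ paths $P_1,P_2,P_3$, called its legs. -}

module Defs where

open import Data.Nat using (ℕ; _≤_; _*_)
open import Data.Bool using (Bool; true; false)
open import Data.Fin using (Fin)
open import Data.List using (List; []; _∷_; _++_; length; filterᵇ; allFin)
open import Data.List.Membership.Propositional using (_∈_)
open import Data.List.Relation.Unary.All using (All)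
open import Data.List.Relation.Unary.AllPairs using (AllPairs)
open import Data.List.Relation.Unary.Unique.Propositional using (Unique)
open import Data.Product using (_×_; _,_; proj₁; proj₂; ∃; ∃-syntax)
open import Data.Sum using (_⊎_)
open import Data.Empty using (⊥)
open import Relation.Binary.PropositionalEquality using (_≡_; _≢_)

record Graph (n : ℕ) : Set where
  field
    adj    : Fin n → Fin n → Bool
    sym    : ∀ x y → adj x y ≡ adj y x
    irrefl : ∀ x → adj x x ≡ false
open Graph public

Adj : ∀ {n} → Graph n → Fin n → Fin n → Set
Adj G x y = adj G x y ≡ true

deg : ∀ {n} → Graph n → Fin n → ℕ
deg {n} G x = length (filterᵇ (adj G x) (allFin n))

Subcubic : ∀ {n} → Graph n → Set
Subcubic G = ∀ x → deg G x ≤ 3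

consec : ∀ {A : Set} → List A → List (A × A)
consec []           = []
consec (x ∷ [])     = []
consec (x ∷ y ∷ xs) = (x , y) ∷ consec (y ∷ xs)

UEdgeIn : ∀ {n} → Fin n → Fin n → List (Fin n × Fin n) → Set
UEdgeIn x y es = (x , y) ∈ es ⊎ (y , x) ∈ es

AdjPair : ∀ {n} → Graph n → Fin n × Fin n → Set
AdjPair G e = Adj G (proj₁ e) (proj₂ e)

IsPath : ∀ {n} → Graph n → List (Fin n) → Set
IsPath G p = Unique p × All (AdjPair G) (consec p)

leg : ∀ {n} → Fin n → Fin n → List (Fin n) → List (Fin n)
leg u v I = u ∷ I ++ v ∷ []

-- Legs are paths, pairwise internally disjoint, and pairwise distinct
-- (at most one leg is the single edge uv, as G is simple).
IsTheta : ∀ {n} → Graph n → Fin n → Fin n → (Fin 3 → List (Fin n)) → Set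
IsTheta G u v I =
  (∀ i → IsPath G (leg u v (I i))) ×
  (∀ i j → i ≢ j → ∀ x → x ∈ I i → x ∈ I j → ⊥) ×
  (∀ i j → i ≢ j → I i ≡ [] → I j ≡ [] → ⊥)

VDisjoint : ∀ {n} → Fin n × Fin n → Fin n × Fin n → Set
VDisjoint e f = proj₁ e ≢ proj₁ f × proj₁ e ≢ proj₂ f ×
                proj₂ e ≢ proj₁ f × proj₂ e ≢ proj₂ f

IsMatching : ∀ {n} → List (Fin n × Fin n) → Set
IsMatching M = AllPairs VDisjoint M

IsUnion : ∀ {n} → Graph n → Fin n → Fin n → (Fin 3 → List (Fin n)) →
          List (Fin n × Fin n) → Set
IsUnion G u v I M =
  All (AdjPair G) M ×
  All (λ e → ∃[ i ] ∃[ j ] (i ≢ j × proj₁ e ∈ leg u v (I i) × proj₂ e ∈ leg u v (I j))) M ×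
  (∀ x y → Adj G x y → (∃[ i ] UEdgeIn x y (consec (leg u v (I i)))) ⊎ UEdgeIn x y M) ×
  (∀ x → ∃[ i ] x ∈ leg u v (I i))

cycEdges : ∀ {n} → List (Fin n) → List (Fin n × Fin n)
cycEdges []       = []
cycEdges (x ∷ xs) = consec (x ∷ xs ++ x ∷ [])

IsCycle : ∀ {n} → Graph n → List (Fin n) → Set
IsCycle G c = 3 ≤ length c × Unique c × All (AdjPair G) (cycEdges c)

module Submission where

-- At most one edge of M meets u and at most one meets v, so at least k² edges of M join
-- the interiors A and B of the same two legs. Listed in the order of their ends along A,
-- these edges contain, by Erdős–Szekeres, k whose ends along B come in the same or in the
-- reverse order. A zigzag walk from u (along A to the first of them, across it, along B to
-- the next, across it, and so on) then uses all k of them. It ends at v, where the third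
-- leg closes it into a cycle, or, in the reverse case, possibly back at u.

open import Defs
open import Data.Nat using (ℕ; _≤_; _*_)
open import Data.Fin using (Fin)
open import Data.List using (List; length)
open import Data.List.Relation.Unary.All using (All)
open import Data.List.Relation.Binary.Sublist.Propositional using (_⊆_)
open import Data.Product using (_×_; proj₁; proj₂; ∃-syntax)

open import Data.Empty using (⊥)
open import Data.Fin using (_≟_)
open import Data.Fin.Patterns using (0F; 1F; 2F)
open import Data.List using ([]; _∷_; _++_; [_]; map; reverse; filter)
open import Data.List.Properties
  using (length-map; filter-all; ++-assoc; unfold-reverse; reverse-involutive; reverse-++)
open import Data.List.Membership.Propositional using (_∈_; _∉_)
open import Data.List.Membership.Propositional.Properties
  using (∈-++⁺ˡ; ∈-++⁺ʳ; ∈-++⁻; ∈-length; ∈-filter⁺; ∈-filter⁻)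
open import Data.List.Relation.Unary.Any using (Any; here; there)
import Data.List.Relation.Unary.Any as Any
import Data.List.Relation.Unary.Any.Properties as Any
open import Data.List.Relation.Unary.All using ([]; _∷_)
import Data.List.Relation.Unary.All as All
import Data.List.Relation.Unary.All.Properties as All
open import Data.List.Relation.Unary.All.Properties using (¬Any⇒All¬; All¬⇒¬Any)
open import Data.List.Relation.Unary.AllPairs using (AllPairs; []; _∷_)
import Data.List.Relation.Unary.AllPairs as AllPairs
import Data.List.Relation.Unary.AllPairs.Properties as AllPairs
open import Data.List.Relation.Unary.Unique.Propositional using (Unique)
import Data.List.Relation.Unary.Unique.Propositional.Properties as Unique
open import Data.List.Relation.Unary.Sorted.TotalOrder.Properties using (Sorted⇒AllPairs)
open import Data.List.Relation.Binary.Disjoint.Propositional using (Disjoint; contractₗ)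
open import Data.List.Relation.Binary.Sublist.Propositional using ([]; _∷_; _∷ʳ_; ⊆-refl; ⊆-trans)
open import Data.List.Relation.Binary.Sublist.Propositional.Properties
  using ([]⊆-universal; ++⁺ʳ; All-resp-⊆; Any-resp-⊆; reverse⁺; filter-⊆)
open import Data.List.Relation.Binary.Permutation.Propositional using (↭-sym; ↭⇒↭ₛ)
open import Data.List.Relation.Binary.Permutation.Propositional.Properties
  using (↭-reverse; ↭-length; All-resp-↭)
import Data.List.Relation.Binary.Permutation.Setoid.Properties as Permutation
import Data.List.Sort as Sort
open import Data.Nat using (suc; zero; _<_; _+_; _<?_; _≤?_; z≤n; s≤s)
open import Data.Nat.Properties
  using ( ≤-refl; ≤-reflexive; ≤-trans; <-trans; ≤-pred; ≮⇒≥; ≰⇒>; <⇒≱; ≤∧≢⇒<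
        ; +-suc; +-mono-≤; +-monoˡ-≤; +-monoʳ-≤; +-cancelˡ-<; m≤n+m; n≤1+n; 0≢1+n; suc-injective
        ; ≤-decTotalOrder; module ≤-Reasoning)
open import Data.Nat.Tactic.RingSolver using (solve-∀)
open import Data.Product using (_,_; ∃₂; swap; uncurry)
open import Data.Product.Properties using (≡-dec)
open import Data.Sum using (_⊎_; inj₁; inj₂)
import Data.Sum as Sum
open import Function using (_∘_; id; flip)
open import Relation.Binary.Bundles using (DecTotalOrder)
import Relation.Binary.Construct.On as On
open import Relation.Binary.Definitions using (DecidableEquality)
open import Relation.Binary.PropositionalEquality using (_≡_; _≢_; refl; cong; subst; subst₂)
import Relation.Binary.PropositionalEquality as ≡
open import Relation.Nullary using (¬_; Dec; yes; no; contradiction)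
open import Relation.Nullary.Decidable using (_⊎-dec_; _×-dec_)
open import Relation.Unary using (Decidable; _∪_)
open import Relation.Unary.Properties using (_∪?_)

module _ {A : Set} where

  consec-∷⁺ : ∀ {e : A × A} x xs → e ∈ consec xs → e ∈ consec (x ∷ xs)
  consec-∷⁺ x (y ∷ xs) p = there p

  consec-∷⁻ : ∀ {e : A × A} {x} xs → e ∈ consec (x ∷ xs) → proj₁ e ≢ x → e ∈ consec xs
  consec-∷⁻ (y ∷ xs) (here refl) e≢x = contradiction refl e≢x
  consec-∷⁻ (y ∷ xs) (there p)   _   = p

  consec-++⁺ˡ : ∀ {e : A × A} xs {ys} → e ∈ consec xs → e ∈ consec (xs ++ ys)
  consec-++⁺ˡ (x ∷ y ∷ xs) (here p)  = here p
  consec-++⁺ˡ (x ∷ y ∷ xs) (there p) = there (consec-++⁺ˡ (y ∷ xs) p)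

  ∈-consec⇒2≤length : ∀ {e : A × A} xs → e ∈ consec xs → 2 ≤ length xs
  ∈-consec⇒2≤length (x ∷ y ∷ xs) _ = s≤s (s≤s z≤n)

  module _ {P : A × A → Set} where

    All-consec-tail : ∀ x xs → All P (consec (x ∷ xs)) → All P (consec xs)
    All-consec-tail x []       _        = []
    All-consec-tail x (y ∷ xs) (_ ∷ ps) = ps

    All-consec-++⁻ˡ : ∀ xs {ys} → All P (consec (xs ++ ys)) → All P (consec xs)
    All-consec-++⁻ˡ []           _        = []
    All-consec-++⁻ˡ (x ∷ [])     _        = []
    All-consec-++⁻ˡ (x ∷ y ∷ xs) (p ∷ ps) = p ∷ All-consec-++⁻ˡ (y ∷ xs) ps

    All-consec-++⁻ʳ : ∀ xs {ys} → All P (consec (xs ++ ys)) → All P (consec ys)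
    All-consec-++⁻ʳ []       ps = ps
    All-consec-++⁻ʳ (x ∷ xs) ps = All-consec-++⁻ʳ xs (All-consec-tail x (xs ++ _) ps)

    All-consec-join : ∀ xs a ys → All P (consec (xs ++ [ a ])) → All P (consec (a ∷ ys)) →
                      All P (consec (xs ++ a ∷ ys))
    All-consec-join []           a ys _        qs = qs
    All-consec-join (x ∷ [])     a ys (p ∷ _)  qs = p ∷ qs
    All-consec-join (x ∷ y ∷ xs) a ys (p ∷ ps) qs = p ∷ All-consec-join (y ∷ xs) a ys ps qs

    All-consec-reverse : (∀ {x y} → P (x , y) → P (y , x)) →
                         ∀ xs → All P (consec xs) → All P (consec (reverse xs))
    All-consec-reverse P-sym []           _        = []
    All-consec-reverse P-sym (x ∷ [])     _        = []
    All-consec-reverse P-sym (x ∷ y ∷ xs) (p ∷ ps) =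
      subst (All P ∘ consec) (≡.sym reverse-∷∷)
        (All-consec-join (reverse xs) y [ x ]
          (subst (All P ∘ consec) (unfold-reverse y xs) (All-consec-reverse P-sym (y ∷ xs) ps))
          (P-sym p ∷ []))
      where
      reverse-∷∷ : reverse (x ∷ y ∷ xs) ≡ reverse xs ++ y ∷ [ x ]
      reverse-∷∷ = ≡.trans (unfold-reverse x (y ∷ xs))
                   (≡.trans (cong (_++ [ x ]) (unfold-reverse y xs)) (++-assoc (reverse xs) [ y ] [ x ]))

  ∷-Unique : ∀ {x : A} {xs} → x ∉ xs → Unique xs → Unique (x ∷ xs)
  ∷-Unique x∉xs u = ¬Any⇒All¬ _ x∉xs ∷ u

  head-∉ : ∀ {h : A} {X Y W} → Unique (h ∷ X) → Disjoint (h ∷ X) Y →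
           (∀ {z} → z ∈ W → z ∈ X ⊎ z ∈ Y) → h ∉ W
  head-∉ (h∉X ∷ _) dXY W⊆ h∈W with W⊆ h∈W
  ... | inj₁ h∈X = All¬⇒¬Any h∉X h∈X
  ... | inj₂ h∈Y = dXY (here refl , h∈Y)

  Unique-++⁻ʳ : ∀ xs {ys : List A} → Unique (xs ++ ys) → Unique ys
  Unique-++⁻ʳ []       u       = u
  Unique-++⁻ʳ (x ∷ xs) (_ ∷ u) = Unique-++⁻ʳ xs u

  ⊆-split : ∀ {x : A} {xs ys} → (x ∷ xs) ⊆ ys → ∃₂ λ P Q → ys ≡ P ++ x ∷ Q × xs ⊆ Q
  ⊆-split (y ∷ʳ s) with ⊆-split s
  ... | P , Q , refl , s′ = y ∷ P , Q , refl , s′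
  ⊆-split (refl ∷ s) = [] , _ , refl , s

  Unique-reverse : ∀ {xs : List A} → Unique xs → Unique (reverse xs)
  Unique-reverse {xs} = Permutation.Unique-resp-↭ (≡.setoid A) (↭⇒↭ₛ (↭-sym (↭-reverse xs)))

  Unique-snoc⇒∉ : ∀ {v : A} xs → Unique (xs ++ [ v ]) → v ∉ xs
  Unique-snoc⇒∉ (x ∷ xs) (x≢ ∷ _) (here refl) = All.lookup x≢ (∈-++⁺ʳ xs (here refl)) refl
  Unique-snoc⇒∉ (x ∷ xs) (_ ∷ u)  (there v∈) = Unique-snoc⇒∉ xs u v∈

  Unique-between⁻ : ∀ {u v : A} xs → Unique (u ∷ xs ++ [ v ]) → u ∉ xs × v ∉ xs × u ≢ v
  Unique-between⁻ xs (u≢ ∷ u′) =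
    All¬⇒¬Any u≢ ∘ ∈-++⁺ˡ , Unique-snoc⇒∉ xs u′ , All.lookup u≢ (∈-++⁺ʳ xs (here refl))

  interior-⊆ : ∀ (u v : A) xs → xs ⊆ u ∷ xs ++ [ v ]
  interior-⊆ u v xs = u ∷ʳ ++⁺ʳ [ v ] ⊆-refl

  ∈-between⁻ : ∀ {u v z : A} xs → z ∈ u ∷ xs ++ [ v ] → z ≡ u ⊎ z ∈ xs ⊎ z ≡ v
  ∈-between⁻ xs (here z≡u) = inj₁ z≡u
  ∈-between⁻ xs (there z∈) with ∈-++⁻ xs z∈
  ... | inj₁ z∈xs        = inj₂ (inj₁ z∈xs)
  ... | inj₂ (here z≡v) = inj₂ (inj₂ z≡v)

  reverse-between : ∀ (u v : A) xs → reverse (u ∷ xs ++ [ v ]) ≡ v ∷ reverse xs ++ [ u ]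
  reverse-between u v xs =
    ≡.trans (reverse-++ [ u ] (xs ++ [ v ])) (cong (_++ [ u ]) (reverse-++ xs [ v ]))

  one-of-two-nonempty : (xs ys : List A) → (xs ≡ [] → ys ≡ [] → ⊥) → xs ≢ [] ⊎ ys ≢ []
  one-of-two-nonempty (_ ∷ _) _       _    = inj₁ λ ()
  one-of-two-nonempty []      (_ ∷ _) _    = inj₂ λ ()
  one-of-two-nonempty []      []      both = contradiction refl (both refl)

  module _ {R : A → A → Set} where

    AllPairs-resp-⊆ : ∀ {xs ys} → ys ⊆ xs → AllPairs R xs → AllPairs R ys
    AllPairs-resp-⊆ []         []       = []
    AllPairs-resp-⊆ (_ ∷ʳ s)   (_ ∷ rs) = AllPairs-resp-⊆ s rs
    AllPairs-resp-⊆ (refl ∷ s) (r ∷ rs) = All-resp-⊆ s r ∷ AllPairs-resp-⊆ s rs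

    AllPairs-reverse : ∀ {xs} → AllPairs R xs → AllPairs (flip R) (reverse xs)
    AllPairs-reverse {[]}     []       = []
    AllPairs-reverse {x ∷ xs} (r ∷ rs) =
      subst (AllPairs (flip R)) (≡.sym (unfold-reverse x xs))
        (AllPairs.++⁺ (AllPairs-reverse rs) ([] ∷ [])
          (All.map (_∷ []) (All-resp-↭ (↭-sym (↭-reverse xs)) r)))

    AllPairs-mapWithAll : ∀ {P : A → Set} {S : A → A → Set} →
                          (∀ {x y} → P x → P y → R x y → S x y) →
                          ∀ {xs} → All P xs → AllPairs R xs → AllPairs S xs
    AllPairs-mapWithAll f []       []       = []
    AllPairs-mapWithAll f (p ∷ ps) (r ∷ rs) =
      All.zipWith (λ (q , r′) → f p q r′) (ps , r) ∷ AllPairs-mapWithAll f ps rs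

module _ {A B : Set} (R : A → B → Set) where

  Exclusive : A → A → Set
  Exclusive x x′ = ∀ {y} → R x y → R x′ y → ⊥

  remove-witness : ∀ {x ys} → Any (R x) ys →
                   ∃[ ys′ ] (length ys ≡ suc (length ys′) ×
                             ∀ {x′} → Exclusive x x′ → Any (R x′) ys → Any (R x′) ys′)
  remove-witness {ys = _ ∷ ys} (here r) =
    ys , refl , λ { excl (here r′) → contradiction r′ (excl r) ; _ (there p) → p }
  remove-witness {ys = y ∷ _} (there p) with remove-witness p
  ... | ys′ , eq , keep =
    y ∷ ys′ , cong suc eq , λ { _ (here r′) → here r′ ; excl (there q) → there (keep excl q) }

  length-≤-by-exclusive-witnesses : ∀ {xs ys} → AllPairs Exclusive xs → All (λ x → Any (R x) ys) xs →
                                    length xs ≤ length ys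
  length-≤-by-exclusive-witnesses []             []       = z≤n
  length-≤-by-exclusive-witnesses {x ∷ _} (excl ∷ excls) (p ∷ ps) with remove-witness p
  ... | ys′ , eq , keep = subst (suc _ ≤_) (≡.sym eq)
    (s≤s (length-≤-by-exclusive-witnesses excls
      (All.zipWith {Q = Exclusive x} (λ (q , e) → keep e q) (ps , excl))))

one-of-three-≥ : ∀ K a b c d e → K + (K + (K + 0)) ≤ a + (b + (c + (d + e))) → a ≤ 1 → b ≤ 1 →
                 K ≤ c ⊎ K ≤ d ⊎ K ≤ e
one-of-three-≥ K a b c d e 3K≤ a≤1 b≤1 with K ≤? c | K ≤? d | K ≤? e
... | yes K≤c | _       | _       = inj₁ K≤c
... | no  _   | yes K≤d | _       = inj₂ (inj₁ K≤d)
... | no  _   | no  _   | yes K≤e = inj₂ (inj₂ K≤e)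
... | no  K≰c | no  K≰d | no  K≰e = contradiction 3K≤ (<⇒≱ (begin-strict
  a + (b + (c + (d + e)))       ≤⟨ +-mono-≤ a≤1 (+-monoˡ-≤ (c + (d + e)) b≤1) ⟩
  2 + (c + (d + e))             <⟨ ≤-refl ⟩
  3 + (c + (d + e))             ≡⟨ rearrange c d e ⟩
  suc c + (suc d + (suc e + 0)) ≤⟨ +-mono-≤ (≰⇒> K≰c) (+-mono-≤ (≰⇒> K≰d) (+-monoˡ-≤ 0 (≰⇒> K≰e))) ⟩
  K + (K + (K + 0))             ∎))
  where
  open ≤-Reasoning
  rearrange : ∀ c d e → 3 + (c + (d + e)) ≡ suc c + (suc d + (suc e + 0))
  rearrange = solve-∀

module _ {A : Set} {P Q : A → Set} (P? : Decidable P) (Q? : Decidable Q) where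

  length-filter-∪ : ∀ xs → length (filter (P? ∪? Q?) xs) ≤ length (filter P? xs) + length (filter Q? xs)
  length-filter-∪ [] = z≤n
  length-filter-∪ (x ∷ xs) with P? x | Q? x
  ... | yes _ | yes _ = s≤s (≤-trans (length-filter-∪ xs) (+-monoʳ-≤ _ (n≤1+n _)))
  ... | yes _ | no  _ = s≤s (length-filter-∪ xs)
  ... | no  _ | yes _ = ≤-trans (s≤s (length-filter-∪ xs)) (≤-reflexive (≡.sym (+-suc _ _)))
  ... | no  _ | no  _ = length-filter-∪ xs

module _ {A : Set} (_≟_ : DecidableEquality A) where

  position : List A → A → ℕ
  position []       z = 0
  position (x ∷ xs) z with x ≟ z
  ... | yes _ = 0
  ... | no  _ = suc (position xs z)

  position-here : ∀ x xs → position (x ∷ xs) x ≡ 0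
  position-here x xs with x ≟ x
  ... | yes _   = refl
  ... | no  x≢x = contradiction refl x≢x

  position-there : ∀ {x z} xs → x ≢ z → position (x ∷ xs) z ≡ suc (position xs z)
  position-there {x} {z} xs x≢z with x ≟ z
  ... | yes x≡z = contradiction x≡z x≢z
  ... | no  _   = refl

  position-injective : ∀ {xs y z} → y ∈ xs → z ∈ xs → position xs y ≡ position xs z → y ≡ z
  position-injective {x ∷ xs} {y} {z} y∈ z∈ eq with x ≟ y | x ≟ z
  ... | yes refl | yes refl = refl
  ... | yes _    | no  _    = contradiction eq 0≢1+n
  ... | no  _    | yes _    = contradiction (≡.sym eq) 0≢1+n
  ... | no  x≢y  | no  x≢z  =
    position-injective (Any.tail (x≢y ∘ ≡.sym) y∈) (Any.tail (x≢z ∘ ≡.sym) z∈) (suc-injective eq)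

  position<⇒≢ : ∀ {x y z} xs → position (x ∷ xs) y < position (x ∷ xs) z → x ≢ z
  position<⇒≢ {x} {y} xs y<z refl =
    contradiction (subst (position (x ∷ xs) y <_) (position-here x xs) y<z) λ ()

  increasing-positions-tail : ∀ {x} xs {zs} → All (x ≢_) zs → All (_∈ x ∷ xs) zs →
                              AllPairs (λ a b → position (x ∷ xs) a < position (x ∷ xs) b) zs →
                              All (_∈ xs) zs × AllPairs (λ a b → position xs a < position xs b) zs
  increasing-positions-tail xs ≢s ∈s lts =
    All.zipWith (λ (x≢z , z∈) → Any.tail (x≢z ∘ ≡.sym) z∈) (≢s , ∈s) ,
    AllPairs-mapWithAll
      (λ x≢a x≢b lt → ≤-pred (subst₂ _<_ (position-there xs x≢a) (position-there xs x≢b) lt)) ≢s lts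

  increasing-positions⇒⊆ : ∀ xs {ys} → All (_∈ xs) ys →
                           AllPairs (λ a b → position xs a < position xs b) ys → ys ⊆ xs
  increasing-positions⇒⊆ xs       {[]}     _          _          = []⊆-universal xs
  increasing-positions⇒⊆ (x ∷ xs) {y ∷ ys} (y∈ ∷ ys∈) (lt ∷ lts) = step (x ≟ y)
    where
    step : Dec (x ≡ y) → y ∷ ys ⊆ x ∷ xs
    step (yes refl) = refl ∷ uncurry (increasing-positions⇒⊆ xs)
      (increasing-positions-tail xs (All.map (position<⇒≢ xs) lt) ys∈ lts)
    step (no x≢y) = x ∷ʳ uncurry (increasing-positions⇒⊆ xs)
      (increasing-positions-tail xs (x≢y ∷ All.map (position<⇒≢ xs) lt) (y∈ ∷ ys∈) (lt ∷ lts))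

module ErdősSzekeres {X : Set} (f : X → ℕ) where

  Increasing Decreasing : List X → Set
  Increasing = AllPairs (λ x y → f x < f y)
  Decreasing = AllPairs (λ x y → f y < f x)

  minima nonMinima : ℕ → List X → List X
  minima m [] = []
  minima m (x ∷ xs) with f x <? m
  ... | yes _ = x ∷ minima (f x) xs
  ... | no  _ = minima m xs

  nonMinima m [] = []
  nonMinima m (x ∷ xs) with f x <? m
  ... | yes _ = nonMinima (f x) xs
  ... | no  _ = x ∷ nonMinima m xs

  minima-⊆ : ∀ m xs → minima m xs ⊆ xs
  minima-⊆ m [] = []
  minima-⊆ m (x ∷ xs) with f x <? m
  ... | yes _ = refl ∷ minima-⊆ (f x) xs
  ... | no  _ = x ∷ʳ minima-⊆ m xs

  nonMinima-⊆ : ∀ m xs → nonMinima m xs ⊆ xs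
  nonMinima-⊆ m [] = []
  nonMinima-⊆ m (x ∷ xs) with f x <? m
  ... | yes _ = x ∷ʳ nonMinima-⊆ (f x) xs
  ... | no  _ = refl ∷ nonMinima-⊆ m xs

  length-minima+nonMinima : ∀ m xs → length (minima m xs) + length (nonMinima m xs) ≡ length xs
  length-minima+nonMinima m [] = refl
  length-minima+nonMinima m (x ∷ xs) with f x <? m
  ... | yes _ = cong suc (length-minima+nonMinima (f x) xs)
  ... | no  _ = ≡.trans (+-suc _ _) (cong suc (length-minima+nonMinima m xs))

  minima-decreasing : ∀ m xs → All (λ y → f y < m) (minima m xs) × Decreasing (minima m xs)
  minima-decreasing m [] = [] , []
  minima-decreasing m (x ∷ xs) with f x <? m
  ... | no  _   = minima-decreasing m xs
  ... | yes x<m =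
    let below , decreasing = minima-decreasing (f x) xs
    in x<m ∷ All.map (λ y<x → <-trans y<x x<m) below , below ∷ decreasing

  prepend : ∀ {x xs y ys} → All (λ b → f x ≢ f b) xs → f x ≤ f y → (y ∷ ys) ⊆ xs →
            (x ∷ y ∷ ys) ⊆ (x ∷ xs) × f x < f y
  prepend ≢s x≤y s = refl ∷ s , ≤∧≢⇒< x≤y (All.lookup ≢s (Any-resp-⊆ s (here refl)))

  nonMinima-extend : ∀ m xs {y ys} → (y ∷ ys) ⊆ nonMinima m xs → AllPairs (λ a b → f a ≢ f b) xs →
                     (∃[ z ] ((z ∷ y ∷ ys) ⊆ xs × f z < f y)) ⊎ (m ≤ f y × (y ∷ ys) ⊆ xs)
  nonMinima-extend m (x ∷ xs) s (≢s ∷ ds) with f x <? m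
  ... | yes _ with nonMinima-extend (f x) xs s ds
  ...   | inj₁ (z , s′ , z<y) = inj₁ (z , x ∷ʳ s′ , z<y)
  ...   | inj₂ (x≤y , s′)     = inj₁ (x , prepend ≢s x≤y s′)
  nonMinima-extend m (x ∷ xs) (.x ∷ʳ s) (≢s ∷ ds) | no _ with nonMinima-extend m xs s ds
  ...   | inj₁ (z , s′ , z<y) = inj₁ (z , x ∷ʳ s′ , z<y)
  ...   | inj₂ (m≤y , s′)     = inj₂ (m≤y , x ∷ʳ s′)
  nonMinima-extend m (x ∷ xs) (refl ∷ s) (≢s ∷ ds) | no x≮m =
    inj₂ (≮⇒≥ x≮m , refl ∷ ⊆-trans s (nonMinima-⊆ m xs))

  cons-increasing : ∀ {z y ys} → f z < f y → Increasing (y ∷ ys) → Increasing (z ∷ y ∷ ys)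
  cons-increasing z<y inc@(y< ∷ _) = (z<y ∷ All.map (<-trans z<y) y<) ∷ inc

  -- Either the left-to-right minima form a long decreasing subsequence, or the other
  -- elements contain a long increasing one; each of these elements has a smaller
  -- predecessor, which extends that subsequence to the left.
  erdős-szekeres : ∀ a b xs → AllPairs (λ x y → f x ≢ f y) xs → a * b < length xs →
                   (∃[ ys ] (ys ⊆ xs × Increasing ys × suc a ≤ length ys)) ⊎
                   (∃[ ys ] (ys ⊆ xs × Decreasing ys × suc b ≤ length ys))
  erdős-szekeres zero    b (x ∷ xs) _ _ = inj₁ ([ x ] , refl ∷ []⊆-universal xs , [] ∷ [] , ≤-refl)
  erdős-szekeres (suc a) b (x ∷ xs) (≢s ∷ ds) ab<
    with b <? length (x ∷ minima (f x) xs)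
  ... | yes b< = let below , decreasing = minima-decreasing (f x) xs
                 in inj₂ (_ , refl ∷ minima-⊆ (f x) xs , below ∷ decreasing , b<)
  ... | no  b≮ with erdős-szekeres a b (nonMinima (f x) xs)
                      (AllPairs-resp-⊆ (nonMinima-⊆ (f x) xs) ds) ab<rest
    where
    L = length (minima (f x) xs)
    H = length (nonMinima (f x) xs)
    ab<rest : a * b < H
    ab<rest = +-cancelˡ-< (suc L) (a * b) H (begin-strict
      suc L + a * b   ≤⟨ +-monoˡ-≤ (a * b) (≮⇒≥ b≮) ⟩
      b + a * b       <⟨ ab< ⟩
      suc (length xs) ≡⟨ cong suc (≡.sym (length-minima+nonMinima (f x) xs)) ⟩
      suc L + H       ∎)
      where open ≤-Reasoning
  ... | inj₂ (ys , s , dec , len) = inj₂ (ys , x ∷ʳ ⊆-trans s (nonMinima-⊆ (f x) xs) , dec , len)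
  ... | inj₁ (y ∷ ys , s , inc , len) with nonMinima-extend (f x) xs s ds
  ...   | inj₁ (z , s′ , z<y) = inj₁ (z ∷ y ∷ ys , x ∷ʳ s′ , cons-increasing z<y inc , s≤s len)
  ...   | inj₂ (x≤y , s′)     = let s″ , x<y = prepend ≢s x≤y s′
                                in inj₁ (x ∷ y ∷ ys , s″ , cons-increasing x<y inc , s≤s len)

module _ {n : ℕ} (G : Graph n) where

  open import Data.List.Membership.DecPropositional (≡-dec (_≟_ {n = n}) (_≟_ {n = n})) using (_∈?_)
  open import Data.List.Membership.DecPropositional (_≟_ {n = n}) using () renaming (_∈?_ to _∈ᵥ?_)

  Adj-sym : ∀ {x y} → Adj G x y → Adj G y x
  Adj-sym {x} {y} xy = ≡.trans (Graph.sym G y x) xy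

  reverse-IsPath : ∀ {p} → IsPath G p → IsPath G (reverse p)
  reverse-IsPath {p} (unique , edges) = Unique-reverse unique , All-consec-reverse Adj-sym p edges

  module _ {C : Set} where

    record Zigzag (ex ey : C → Fin n) (h : Fin n) (X Y : List (Fin n)) (tX tY : Fin n)
                  (cs : List C) : Set where
      field
        rest   : List (Fin n)
        end    : Fin n
        end-≡  : end ≡ tX ⊎ end ≡ tY
        edges  : All (AdjPair G) (consec (h ∷ rest ++ [ end ]))
        unique : Unique (h ∷ rest)
        rest-∈ : ∀ {z} → z ∈ rest → z ∈ X ⊎ z ∈ Y
        chords : All (λ c → UEdgeIn (ex c) (ey c) (consec (h ∷ rest))) cs

    module _ {ex ey : C → Fin n} {tX tY : Fin n} where

      Zigzag-walk : ∀ {h x X Y cs} → Unique (h ∷ x ∷ X) → Disjoint (h ∷ x ∷ X) Y → Adj G h x →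
                    Zigzag ex ey x X Y tX tY cs → Zigzag ex ey h (x ∷ X) Y tX tY cs
      Zigzag-walk {h} {x} {X} {Y} uX dXY hx W = record
        { rest = x ∷ W.rest ; end = W.end ; end-≡ = W.end-≡ ; edges = hx ∷ W.edges
        ; unique = ∷-Unique (head-∉ uX dXY rest-∈) W.unique ; rest-∈ = rest-∈
        ; chords = All.map (Sum.map (consec-∷⁺ h _) (consec-∷⁺ h _)) W.chords }
        where
        module W = Zigzag W
        rest-∈ : ∀ {z} → z ∈ x ∷ W.rest → z ∈ x ∷ X ⊎ z ∈ Y
        rest-∈ (here z≡x) = inj₁ (here z≡x)
        rest-∈ (there z∈) = Sum.map₁ there (W.rest-∈ z∈)

      Zigzag-cross : ∀ {c cs X} P {Y′} → Unique (ex c ∷ X) → Disjoint (ex c ∷ X) (P ++ ey c ∷ Y′) →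
                     Adj G (ex c) (ey c) → Zigzag ey ex (ey c) Y′ X tY tX cs →
                     Zigzag ex ey (ex c) X (P ++ ey c ∷ Y′) tX tY (c ∷ cs)
      Zigzag-cross {c} {X = X} P {Y′} uX dXY a W = record
        { rest = ey c ∷ W.rest ; end = W.end ; end-≡ = Sum.swap W.end-≡ ; edges = a ∷ W.edges
        ; unique = ∷-Unique (head-∉ uX dXY rest-∈) W.unique ; rest-∈ = rest-∈
        ; chords = inj₁ (here refl)
                   ∷ All.map (Sum.swap ∘ Sum.map (consec-∷⁺ _ _) (consec-∷⁺ _ _)) W.chords }
        where
        module W = Zigzag W
        rest-∈ : ∀ {z} → z ∈ ey c ∷ W.rest → z ∈ X ⊎ z ∈ P ++ ey c ∷ Y′
        rest-∈ (here z≡y) = inj₂ (∈-++⁺ʳ P (here z≡y))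
        rest-∈ (there z∈) = Sum.swap (Sum.map₁ (∈-++⁺ʳ P ∘ there) (W.rest-∈ z∈))

    zigzag : ∀ ex ey cs h X Y {tX tY} →
             map ex cs ⊆ h ∷ X → map ey cs ⊆ Y →
             Unique (h ∷ X) → Unique Y → Disjoint (h ∷ X) Y →
             All (AdjPair G) (consec (h ∷ X ++ [ tX ])) → All (AdjPair G) (consec (Y ++ [ tY ])) →
             All (λ c → Adj G (ex c) (ey c)) cs →
             Zigzag ex ey h X Y tX tY cs
    zigzag ex ey [] h X Y _ _ uX _ _ eX _ _ = record
      { rest = X ; end = _ ; end-≡ = inj₁ refl ; edges = eX ; unique = uX ; rest-∈ = inj₁ ; chords = [] }
    zigzag ex ey cs@(_ ∷ _) h (x ∷ X) Y (.h ∷ʳ sX) sY uX uY dXY (hx ∷ eX) eY adj =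
      Zigzag-walk uX dXY hx (zigzag ex ey cs x X Y sX sY (AllPairs.tail uX) uY (contractₗ dXY) eX eY adj)
    zigzag ex ey (c ∷ cs) h X Y (refl ∷ sX) sY uX uY dXY eX eY (a ∷ adj) with ⊆-split sY
    ... | P , Y′ , refl , sY′ =
      Zigzag-cross P uX dXY a
        (zigzag ey ex cs (ey c) Y′ X (ey c ∷ʳ sY′) sX (Unique-++⁻ʳ P uY) (AllPairs.tail uX)
          (λ (z∈Y′ , z∈X) → dXY (there z∈X , ∈-++⁺ʳ P z∈Y′))
          (All-consec-++⁻ʳ P (subst (All (AdjPair G) ∘ consec) (++-assoc P (ey c ∷ Y′) _) eY))
          (All-consec-tail h _ eX) (All.map Adj-sym adj))

  cycle-of-two-paths : ∀ {u v W C} → IsPath G (u ∷ W ++ [ v ]) → IsPath G (u ∷ C ++ [ v ]) →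
                       Disjoint W C → W ≢ [] → IsCycle G (u ∷ W ++ v ∷ reverse C)
  cycle-of-two-paths {W = []} _ _ _ W≢[] = contradiction refl W≢[]
  cycle-of-two-paths {u} {v} {w ∷ W} {C} (uP , eP) (uQ , eQ) dWC _
    with u∉C , v∉C , _ ← Unique-between⁻ C uQ =
    s≤s (s≤s (∈-length (∈-++⁺ʳ W (here refl)))) ,
    subst Unique (cong (u ∷_) (++-assoc (w ∷ W) [ v ] (reverse C)))
      (Unique.++⁺ uP (Unique-reverse (AllPairs-resp-⊆ (interior-⊆ u v C) uQ)) disj) ,
    subst (All (AdjPair G) ∘ consec) (cong (u ∷_) (≡.sym (++-assoc (w ∷ W) (v ∷ reverse C) [ u ])))
      (All-consec-join (u ∷ w ∷ W) v (reverse C ++ [ u ]) eP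
        (subst (All (AdjPair G) ∘ consec) (reverse-between u v C) (proj₂ (reverse-IsPath (uQ , eQ)))))
    where
    disj : Disjoint (u ∷ (w ∷ W) ++ [ v ]) (reverse C)
    disj (z∈P , z∈rC) with ∈-between⁻ (w ∷ W) z∈P
    ... | inj₁ refl         = u∉C (Any.reverse⁻ z∈rC)
    ... | inj₂ (inj₁ z∈W)  = dWC (z∈W , Any.reverse⁻ z∈rC)
    ... | inj₂ (inj₂ refl) = v∉C (Any.reverse⁻ z∈rC)

  UEdgeIn-mono : ∀ {x y : Fin n} {es es′} → (∀ {e} → e ∈ es → e ∈ es′) → UEdgeIn x y es → UEdgeIn x y es′
  UEdgeIn-mono f = Sum.map f f

  SameEdge : Fin n × Fin n → Fin n × Fin n → Set
  SameEdge e f = e ≡ f ⊎ e ≡ swap f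

  VDisjoint-resp-SameEdge : ∀ {e e′ f f′} → SameEdge e′ e → SameEdge f′ f →
                            VDisjoint e f → VDisjoint e′ f′
  VDisjoint-resp-SameEdge (inj₁ refl) (inj₁ refl) d               = d
  VDisjoint-resp-SameEdge (inj₁ refl) (inj₂ refl) (a , b , c , d) = b , a , d , c
  VDisjoint-resp-SameEdge (inj₂ refl) (inj₁ refl) (a , b , c , d) = c , d , a , b
  VDisjoint-resp-SameEdge (inj₂ refl) (inj₂ refl) (a , b , c , d) = d , c , b , a

  VDisjoint-sym : ∀ {e f : Fin n × Fin n} → VDisjoint e f → VDisjoint f e
  VDisjoint-sym (a , b , c , d) = a ∘ ≡.sym , c ∘ ≡.sym , b ∘ ≡.sym , d ∘ ≡.sym

  CycleThrough : List (Fin n × Fin n) → ℕ → Set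
  CycleThrough M k = ∃[ c ] (IsCycle G c × ∃[ S ] (S ⊆ M × k ≤ length S ×
                       All (λ e → UEdgeIn (proj₁ e) (proj₂ e) (cycEdges c)) S))

  CycleThrough-mono : ∀ {M k l} → k ≤ l → CycleThrough M l → CycleThrough M k
  CycleThrough-mono k≤l (c , cyc , S , S⊆M , l≤S , on-c) = c , cyc , S , S⊆M , ≤-trans k≤l l≤S , on-c

  -- Being pairwise vertex-disjoint, no two chords are orientations of the same edge of M.
  chords⇒CycleThrough : ∀ {M c zs} → IsCycle G c →
                        All (λ z → UEdgeIn (proj₁ z) (proj₂ z) (cycEdges c)) zs →
                        All (λ z → UEdgeIn (proj₁ z) (proj₂ z) M) zs → AllPairs VDisjoint zs →
                        CycleThrough M (length zs)
  chords⇒CycleThrough {M} {c} {zs} cyc on-c in-M disj =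
    c , cyc , filter on-c? M , filter-⊆ on-c? M ,
    length-≤-by-exclusive-witnesses (λ z s → SameEdge s z)
      (AllPairs.map (λ d {s} s≈z s≈z′ → proj₁ (VDisjoint-resp-SameEdge {f′ = s} s≈z s≈z′ d) refl) disj)
      (All.zipWith witness (on-c , in-M)) ,
    All.all-filter on-c? M
    where
    on-c? : Decidable (λ e → UEdgeIn (proj₁ e) (proj₂ e) (cycEdges c))
    on-c? e = (e ∈? cycEdges c) ⊎-dec (swap e ∈? cycEdges c)
    witness : ∀ {z} → UEdgeIn (proj₁ z) (proj₂ z) (cycEdges c) × UEdgeIn (proj₁ z) (proj₂ z) M →
              Any (λ s → SameEdge s z) (filter on-c? M)
    witness (z∈c , inj₁ z∈M) = Any.map (inj₁ ∘ ≡.sym) (∈-filter⁺ on-c? z∈M z∈c)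
    witness (z∈c , inj₂ z∈M) = Any.map (inj₂ ∘ ≡.sym) (∈-filter⁺ on-c? z∈M (Sum.swap z∈c))

  module ThreeLegs (M : List (Fin n × Fin n)) {u v : Fin n} {A B C : List (Fin n)}
                   (pA : IsPath G (leg u v A)) (pB : IsPath G (leg u v B)) (pC : IsPath G (leg u v C))
                   (dAB : Disjoint A B) (dAC : Disjoint A C) (dBC : Disjoint B C) where

    Chord : Fin n × Fin n → Set
    Chord z = proj₁ z ∈ A × proj₂ z ∈ B × AdjPair G z × UEdgeIn (proj₁ z) (proj₂ z) M

    -- Y is B traversed towards v (t = v) or reverse B traversed towards u (t = u).
    ordered-chords⇒CycleThrough : ∀ {Y t} z zs → (∀ {y} → y ∈ Y → y ∈ B) → Unique Y →
                                  All (AdjPair G) (consec (Y ++ [ t ])) → t ≡ v ⊎ t ≡ u →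
                                  All Chord (z ∷ zs) → AllPairs VDisjoint (z ∷ zs) →
                                  map proj₁ (z ∷ zs) ⊆ A → map proj₂ (z ∷ zs) ⊆ Y →
                                  CycleThrough M (length (z ∷ zs))
    ordered-chords⇒CycleThrough {Y} {t} z zs Y⊆B uY eY t≡ isChord disj sA sY
      with u∉A , v∉A , u≢v ← Unique-between⁻ A (proj₁ pA)
         | u∉B , v∉B , _  ← Unique-between⁻ B (proj₁ pB) = close end≡
      where
      disjAY : Disjoint (u ∷ A) Y
      disjAY (here refl , u∈Y) = u∉B (Y⊆B u∈Y)
      disjAY (there a∈A , a∈Y) = dAB (a∈A , Y⊆B a∈Y)

      open Zigzag (zigzag proj₁ proj₂ (z ∷ zs) u A Y (u ∷ʳ sA) sY
                     (AllPairs-resp-⊆ (++⁺ʳ [ v ] ⊆-refl) (proj₁ pA)) uY disjAY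
                     (proj₂ pA) eY (All.map (proj₁ ∘ proj₂ ∘ proj₂) isChord))

      rest-AB : ∀ {x} → x ∈ rest → x ∈ A ⊎ x ∈ B
      rest-AB = Sum.map₂ Y⊆B ∘ rest-∈

      end≡ : end ≡ v ⊎ end ≡ u
      end≡ = Sum.[ inj₁ , (λ end≡t → Sum.map (≡.trans end≡t) (≡.trans end≡t) t≡) ]′ end-≡

      2≤rest : 2 ≤ length rest
      2≤rest with All.head chords
      ... | inj₁ z∈ = ∈-consec⇒2≤length rest
                        (consec-∷⁻ rest z∈ λ { refl → u∉A (Any-resp-⊆ sA (here refl)) })
      ... | inj₂ z∈ = ∈-consec⇒2≤length rest
                        (consec-∷⁻ rest z∈ λ { refl → u∉B (Y⊆B (Any-resp-⊆ sY (here refl))) })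

      on-cycle : ∀ {ys} → (∀ {e} → e ∈ consec (u ∷ rest) → e ∈ consec ys) →
                 All (λ z → UEdgeIn (proj₁ z) (proj₂ z) (consec ys)) (z ∷ zs)
      on-cycle sub = All.map (UEdgeIn-mono sub) chords

      edges-to : ∀ {w} → end ≡ w → All (AdjPair G) (consec (u ∷ rest ++ [ w ]))
      edges-to refl = edges

      close : end ≡ v ⊎ end ≡ u → CycleThrough M (length (z ∷ zs))
      close (inj₁ end≡v) = chords⇒CycleThrough
        (cycle-of-two-paths (Unique.++⁺ unique ([] ∷ []) v-fresh , edges-to end≡v) pC
          (λ (x∈rest , x∈C) →
            Sum.[ (λ x∈A → dAC (x∈A , x∈C)) , (λ x∈B → dBC (x∈B , x∈C)) ] (rest-AB x∈rest))
          (λ rest≡[] → contradiction (subst ((2 ≤_) ∘ length) rest≡[] 2≤rest) λ ()))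
        (on-cycle (consec-++⁺ˡ _ ∘ consec-++⁺ˡ (u ∷ rest)))
        (All.map (proj₂ ∘ proj₂ ∘ proj₂) isChord) disj
        where
        v-fresh : Disjoint (u ∷ rest) [ v ]
        v-fresh (here refl , here u≡v) = u≢v u≡v
        v-fresh (there v∈ , here refl) = Sum.[ v∉A , v∉B ] (rest-AB v∈)
      close (inj₂ end≡u) = chords⇒CycleThrough (s≤s 2≤rest , unique , edges-to end≡u)
        (on-cycle (consec-++⁺ˡ (u ∷ rest)))
        (All.map (proj₂ ∘ proj₂ ∘ proj₂) isChord) disj

    many-chords⇒CycleThrough : ∀ k zs → All Chord zs → AllPairs VDisjoint zs →
                               suc k * suc k ≤ length zs → CycleThrough M (suc k)
    many-chords⇒CycleThrough k zs isChord disj k²≤ =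
      from-subsequence (erdős-szekeres k (suc k) sorted distinct-B k[k+1]<)
      where
      keyA keyB : Fin n × Fin n → ℕ
      keyA z = position _≟_ A (proj₁ z)
      keyB z = position _≟_ B (proj₂ z)

      byA = On.decTotalOrder ≤-decTotalOrder keyA
      module SortA = Sort byA
      open ErdősSzekeres keyB

      sorted = SortA.sort zs
      sorted↭zs = SortA.sort-↭ zs

      isChord′ : All Chord sorted
      isChord′ = All-resp-↭ (↭-sym sorted↭zs) isChord

      disj′ : AllPairs VDisjoint sorted
      disj′ = Permutation.AllPairs-resp-↭ (≡.setoid _) VDisjoint-sym (≡.resp₂ VDisjoint)
                (↭⇒↭ₛ (↭-sym sorted↭zs)) disj

      distinct-B : AllPairs (λ a b → keyB a ≢ keyB b) sorted
      distinct-B = AllPairs-mapWithAll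
        (λ ca cb d → proj₂ (proj₂ (proj₂ d))
                   ∘ position-injective _≟_ (proj₁ (proj₂ ca)) (proj₁ (proj₂ cb)))
        isChord′ disj′

      k[k+1]< : k * suc k < length sorted
      k[k+1]< = ≤-trans (s≤s (m≤n+m (k * suc k) k))
                  (≤-trans k²≤ (≤-reflexive (≡.sym (↭-length sorted↭zs))))

      nondecreasing : AllPairs (λ a b → keyA a ≤ keyA b) sorted
      nondecreasing = Sorted⇒AllPairs (DecTotalOrder.totalOrder byA) (SortA.sort-↗ zs)

      A-ends-⊆ : ∀ {ys} → ys ⊆ sorted → map proj₁ ys ⊆ A
      A-ends-⊆ s = increasing-positions⇒⊆ _≟_ A (All.map⁺ (All.map proj₁ cs)) (AllPairs.map⁺ increasing)
        where
        cs = All-resp-⊆ s isChord′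
        increasing = AllPairs-mapWithAll
          (λ ca cb (a≤b , d) → ≤∧≢⇒< a≤b (proj₁ d ∘ position-injective _≟_ (proj₁ ca) (proj₁ cb))) cs
          (AllPairs.zip (AllPairs-resp-⊆ s nondecreasing , AllPairs-resp-⊆ s disj′))

      uB : Unique B
      uB = AllPairs-resp-⊆ (interior-⊆ u v B) (proj₁ pB)

      from-subsequence : (∃[ ys ] (ys ⊆ sorted × Increasing ys × suc k ≤ length ys)) ⊎
                         (∃[ ys ] (ys ⊆ sorted × Decreasing ys × suc (suc k) ≤ length ys)) →
                         CycleThrough M (suc k)
      from-subsequence (inj₁ (y ∷ ys , s , inc , len)) = CycleThrough-mono len
        (ordered-chords⇒CycleThrough y ys id uB (All-consec-tail u (B ++ [ v ]) (proj₂ pB)) (inj₁ refl)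
          cs (AllPairs-resp-⊆ s disj′) (A-ends-⊆ s)
          (increasing-positions⇒⊆ _≟_ B (All.map⁺ (All.map (proj₁ ∘ proj₂) cs)) (AllPairs.map⁺ inc)))
        where cs = All-resp-⊆ s isChord′
      from-subsequence (inj₂ (y ∷ ys , s , dec , len)) = CycleThrough-mono (≤-trans (n≤1+n (suc k)) len)
        (ordered-chords⇒CycleThrough y ys Any.reverse⁻ (Unique-reverse uB) reverse-edges (inj₂ refl)
          cs (AllPairs-resp-⊆ s disj′) (A-ends-⊆ s) B-ends-⊆)
        where
        cs = All-resp-⊆ s isChord′
        reverse-edges : All (AdjPair G) (consec (reverse B ++ [ u ]))
        reverse-edges = subst (All (AdjPair G) ∘ consec) (unfold-reverse u B)
          (All-consec-reverse Adj-sym (u ∷ B) (All-consec-++⁻ˡ (u ∷ B) (proj₂ pB)))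
        B-ends-⊆ : map proj₂ (y ∷ ys) ⊆ reverse B
        B-ends-⊆ = subst (_⊆ reverse B) (reverse-involutive _) (reverse⁺
          (increasing-positions⇒⊆ _≟_ B
            (All-resp-↭ (↭-sym (↭-reverse _)) (All.map⁺ (All.map (proj₁ ∘ proj₂) cs)))
            (AllPairs-reverse (AllPairs.map⁺ dec))))

  Touches : Fin n → Fin n × Fin n → Set
  Touches w e = proj₁ e ≡ w ⊎ proj₂ e ≡ w

  Touches? : ∀ w → Decidable (Touches w)
  Touches? w e = (proj₁ e ≟ w) ⊎-dec (proj₂ e ≟ w)

  Joins : List (Fin n) → List (Fin n) → Fin n × Fin n → Set
  Joins X Y e = (proj₁ e ∈ X × proj₂ e ∈ Y) ⊎ (proj₁ e ∈ Y × proj₂ e ∈ X)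

  Joins? : ∀ X Y → Decidable (Joins X Y)
  Joins? X Y e = (proj₁ e ∈ᵥ? X ×-dec proj₂ e ∈ᵥ? Y) ⊎-dec (proj₁ e ∈ᵥ? Y ×-dec proj₂ e ∈ᵥ? X)

  matching-touching-≤1 : ∀ w {L} → AllPairs VDisjoint L → All (Touches w) L → length L ≤ 1
  matching-touching-≤1 w []              _            = z≤n
  matching-touching-≤1 w (_ ∷ [])        _            = s≤s z≤n
  matching-touching-≤1 w ((d ∷ _) ∷ _ ∷ _) (t ∷ t′ ∷ _) = contradiction d (shared t t′)
    where
    shared : ∀ {e f} → Touches w e → Touches w f → ¬ VDisjoint e f
    shared (inj₁ p) (inj₁ q) (a , _ , _ , _) = a (≡.trans p (≡.sym q))
    shared (inj₁ p) (inj₂ q) (_ , b , _ , _) = b (≡.trans p (≡.sym q))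
    shared (inj₂ p) (inj₁ q) (_ , _ , c , _) = c (≡.trans p (≡.sym q))
    shared (inj₂ p) (inj₂ q) (_ , _ , _ , d) = d (≡.trans p (≡.sym q))

  orient : List (Fin n) → Fin n × Fin n → Fin n × Fin n
  orient X e with proj₁ e ∈ᵥ? X
  ... | yes _ = e
  ... | no  _ = swap e

  orient-SameEdge : ∀ X e → SameEdge (orient X e) e
  orient-SameEdge X e with proj₁ e ∈ᵥ? X
  ... | yes _ = inj₁ refl
  ... | no  _ = inj₂ refl

  orient-Joins : ∀ {X Y e} → Disjoint X Y → Joins X Y e → proj₁ (orient X e) ∈ X × proj₂ (orient X e) ∈ Y
  orient-Joins {X} {e = e} dXY joins with proj₁ e ∈ᵥ? X | joins
  ... | yes _    | inj₁ ends          = ends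
  ... | yes e₁∈X | inj₂ (e₁∈Y , _)    = contradiction (e₁∈X , e₁∈Y) dXY
  ... | no  e₁∉X | inj₁ (e₁∈X , _)    = contradiction e₁∈X e₁∉X
  ... | no  _    | inj₂ (e₁∈Y , e₂∈X) = e₂∈X , e₁∈Y

  AdjPair-resp-SameEdge : ∀ {e e′} → SameEdge e′ e → AdjPair G e → AdjPair G e′
  AdjPair-resp-SameEdge (inj₁ refl) a = a
  AdjPair-resp-SameEdge (inj₂ refl) a = Adj-sym a

  UEdgeIn-resp-SameEdge : ∀ {e e′ es} → SameEdge e′ e → e ∈ es → UEdgeIn (proj₁ e′) (proj₂ e′) es
  UEdgeIn-resp-SameEdge (inj₁ refl) e∈ = inj₁ e∈
  UEdgeIn-resp-SameEdge (inj₂ refl) e∈ = inj₂ e∈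

  module Theta {u v : Fin n} {I : Fin 3 → List (Fin n)} {M : List (Fin n × Fin n)}
               (θ : IsTheta G u v I) (matching : IsMatching M) (union : IsUnion G u v I M) where

    legs : ∀ i → IsPath G (leg u v (I i))
    legs = proj₁ θ

    disjoint : ∀ {i j} → i ≢ j → Disjoint (I i) (I j)
    disjoint {i} {j} i≢j (x∈i , x∈j) = proj₁ (proj₂ θ) i j i≢j _ x∈i x∈j

    CycleThrough-zero : CycleThrough M 0
    CycleThrough-zero = Sum.[ through 0F 2F (λ ()) , through 1F 2F (λ ()) ]′
                   (one-of-two-nonempty (I 0F) (I 1F) (proj₂ (proj₂ θ) 0F 1F λ ()))
      where
      through : ∀ i j → i ≢ j → I i ≢ [] → CycleThrough M 0
      through i j i≢j I≢[] =
        _ , cycle-of-two-paths (legs i) (legs j) (disjoint i≢j) I≢[] , [] , []⊆-universal M , z≤n , []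

    large-class⇒CycleThrough : ∀ {k} i j l → i ≢ j → i ≢ l → j ≢ l →
                               suc k * suc k ≤ length (filter (Joins? (I i) (I j)) M) →
                               CycleThrough M (suc k)
    large-class⇒CycleThrough {k} i j l i≢j i≢l j≢l large =
      many-chords⇒CycleThrough k (map (orient (I i)) F) (All.map⁺ (All.tabulate chord))
        (AllPairs.map⁺ (AllPairs.map
          (λ {e} {f} → VDisjoint-resp-SameEdge (orient-SameEdge (I i) e) (orient-SameEdge (I i) f))
          (AllPairs.filter⁺ (Joins? (I i) (I j)) matching)))
        (subst (suc k * suc k ≤_) (≡.sym (length-map (orient (I i)) F)) large)
      where
      open ThreeLegs M (legs i) (legs j) (legs l) (disjoint i≢j) (disjoint i≢l) (disjoint j≢l)
      F = filter (Joins? (I i) (I j)) M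
      chord : ∀ {e} → e ∈ F → Chord (orient (I i) e)
      chord {e} e∈F with e∈M , joins ← ∈-filter⁻ (Joins? (I i) (I j)) e∈F =
        let e₁∈ , e₂∈ = orient-Joins {I i} (disjoint i≢j) joins in
        e₁∈ , e₂∈ , AdjPair-resp-SameEdge (orient-SameEdge (I i) e) (All.lookup (proj₁ union) e∈M) ,
        UEdgeIn-resp-SameEdge (orient-SameEdge (I i) e) e∈M

    Interior : Fin n × Fin n → Set
    Interior = Joins (I 0F) (I 1F) ∪ Joins (I 0F) (I 2F) ∪ Joins (I 1F) (I 2F)

    interior-pair : ∀ i j {e} → i ≢ j → proj₁ e ∈ I i → proj₂ e ∈ I j → Interior e
    interior-pair 0F 0F i≢j _ _ = contradiction refl i≢j
    interior-pair 1F 1F i≢j _ _ = contradiction refl i≢j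
    interior-pair 2F 2F i≢j _ _ = contradiction refl i≢j
    interior-pair 0F 1F _ p q = inj₁ (inj₁ (p , q))
    interior-pair 1F 0F _ p q = inj₁ (inj₂ (p , q))
    interior-pair 0F 2F _ p q = inj₂ (inj₁ (inj₁ (p , q)))
    interior-pair 2F 0F _ p q = inj₂ (inj₁ (inj₂ (p , q)))
    interior-pair 1F 2F _ p q = inj₂ (inj₂ (inj₁ (p , q)))
    interior-pair 2F 1F _ p q = inj₂ (inj₂ (inj₂ (p , q)))

    classify : ∀ {e} → ∃[ i ] ∃[ j ] (i ≢ j × proj₁ e ∈ leg u v (I i) × proj₂ e ∈ leg u v (I j)) →
               (Touches u ∪ Touches v ∪ Interior) e
    classify (i , j , i≢j , e₁∈ , e₂∈) with ∈-between⁻ (I i) e₁∈ | ∈-between⁻ (I j) e₂∈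
    ... | inj₁ e₁≡u          | _                  = inj₁ (inj₁ e₁≡u)
    ... | inj₂ (inj₂ e₁≡v)   | _                  = inj₂ (inj₁ (inj₁ e₁≡v))
    ... | _                  | inj₁ e₂≡u          = inj₁ (inj₂ e₂≡u)
    ... | _                  | inj₂ (inj₂ e₂≡v)   = inj₂ (inj₁ (inj₂ e₂≡v))
    ... | inj₂ (inj₁ e₁∈Ii)  | inj₂ (inj₁ e₂∈Ij)  = inj₂ (inj₂ (interior-pair i j i≢j e₁∈Ii e₂∈Ij))

    some-class-large : ∀ K → 3 * K ≤ length M →
                       K ≤ length (filter (Joins? (I 0F) (I 1F)) M) ⊎
                       K ≤ length (filter (Joins? (I 0F) (I 2F)) M) ⊎
                       K ≤ length (filter (Joins? (I 1F) (I 2F)) M)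
    some-class-large K 3K≤ = one-of-three-≥ K _ _ _ _ _ (≤-trans 3K≤ count) (touching u) (touching v)
      where
      touching : ∀ w → length (filter (Touches? w) M) ≤ 1
      touching w =
        matching-touching-≤1 w (AllPairs.filter⁺ (Touches? w) matching) (All.all-filter (Touches? w) M)
      Tu? = Touches? u
      Tv? = Touches? v
      J₀₁? = Joins? (I 0F) (I 1F)
      J₀₂? = Joins? (I 0F) (I 2F)
      J₁₂? = Joins? (I 1F) (I 2F)
      size : ∀ {P : Fin n × Fin n → Set} → Decidable P → ℕ
      size P? = length (filter P? M)
      count : length M ≤ size Tu? + (size Tv? + (size J₀₁? + (size J₀₂? + size J₁₂?)))
      count = begin
        length M
          ≡⟨ cong length (≡.sym (filter-all (Tu? ∪? Tv? ∪? J₀₁? ∪? J₀₂? ∪? J₁₂?)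
                                   (All.map classify (proj₁ (proj₂ union))))) ⟩
        size (Tu? ∪? Tv? ∪? J₀₁? ∪? J₀₂? ∪? J₁₂?)
          ≤⟨ length-filter-∪ Tu? (Tv? ∪? J₀₁? ∪? J₀₂? ∪? J₁₂?) M ⟩
        size Tu? + size (Tv? ∪? J₀₁? ∪? J₀₂? ∪? J₁₂?)
          ≤⟨ +-monoʳ-≤ (size Tu?) (length-filter-∪ Tv? (J₀₁? ∪? J₀₂? ∪? J₁₂?) M) ⟩
        size Tu? + (size Tv? + size (J₀₁? ∪? J₀₂? ∪? J₁₂?))
          ≤⟨ +-monoʳ-≤ (size Tu?) (+-monoʳ-≤ (size Tv?) (length-filter-∪ J₀₁? (J₀₂? ∪? J₁₂?) M)) ⟩
        size Tu? + (size Tv? + (size J₀₁? + size (J₀₂? ∪? J₁₂?)))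
          ≤⟨ +-monoʳ-≤ (size Tu?) (+-monoʳ-≤ (size Tv?)
               (+-monoʳ-≤ (size J₀₁?) (length-filter-∪ J₀₂? J₁₂? M))) ⟩
        size Tu? + (size Tv? + (size J₀₁? + (size J₀₂? + size J₁₂?))) ∎
        where open ≤-Reasoning

lemma3p3 : (k n : ℕ) (G : Graph n) (u v : Fin n) (I : Fin 3 → List (Fin n))
    (M : List (Fin n × Fin n)) →
    Subcubic G → IsTheta G u v I → IsMatching M → IsUnion G u v I M →
    3 * (k * k) ≤ length M →
    ∃[ c ] (IsCycle G c × ∃[ S ] (S ⊆ M × k ≤ length S ×
    All (λ e → UEdgeIn (proj₁ e) (proj₂ e) (cycEdges c)) S))
lemma3p3 zero    n G u v I M _ θ matching union _    = Theta.CycleThrough-zero G θ matching union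
lemma3p3 (suc k) n G u v I M _ θ matching union 3k²≤ =
  Sum.[ large-class⇒CycleThrough 0F 1F 2F (λ ()) (λ ()) (λ ())
      , Sum.[ large-class⇒CycleThrough 0F 2F 1F (λ ()) (λ ()) (λ ())
            , large-class⇒CycleThrough 1F 2F 0F (λ ()) (λ ()) (λ ()) ]′ ]′
    (some-class-large (suc k * suc k) 3k²≤)
  where open Theta G θ matching union
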